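{- Let $q$ be a prime power and $n$ a positive integer. Both the minimum distance and the stopping distance of the binary code $\mathcal{C}(n,q)$ (with respect to the parity-check matrix $H(n,q)$) are at least $\frac{2(q^n-1)}{q-1}$.
   Context: $\mathbb{S}_n(\mathbb{F}_q)$ denotes the set of $n\times n$ symmetric matrices over $\mathbb{F}_q$ (its elements are called points). Two points $S,S'$ are adjacent if $\operatorname{rank}(S-S')=1$. A line is a maximal set of rank $1$: a subset $\mathcal{M}\subseteq\mathbb{S}_n(\mathbb{F}_q)$ such that any two distinct points of $\mathcal{M}$ are adjacent and no point of $\mathbb{S}_n(\mathbb{F}_q)\setminus\mathcal{M}$ is adjacent to every point of $\mathcal{M}$. $H(n,q)$ is the binary matrix with rows indexed by the lines and columns indexed by the points, whose (line, point) entry is $1$ iff the point belongs to the line. $\mathcal{C}(n,q)=\{c\in\mathbb{F}_2^{\text{points}}: H(n,q)c=0\}$. For a binary code given as the null space of a parity-check matrix $H$, a stopping set is a set $T$ of coordinate positions such that no row of $H$ has exactly one $1$ among the positions in $T$; the stopping distance is the minimum size of a nonempty stopping set. -}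

module Defs where

open import Data.Nat using (ℕ; _∸_; _^_; _≤_) renaming (_*_ to _·_)
open import Data.Nat.Divisibility using (_∣_)
open import Data.Fin using (Fin)
open import Data.Bool using (Bool; true; false)
open import Data.List using (List; []; length; filterᵇ)
open import Data.List.Relation.Unary.All using (All)
open import Data.List.Relation.Unary.AllPairs using (AllPairs)
open import Data.Product using (Σ; ∃; ∃₂; _×_)
open import Relation.Nullary using (¬_)
open import Relation.Binary.PropositionalEquality using (_≡_)
open import Algebra.Core using (Op₁; Op₂)
open import Algebra.Structures using (IsCommutativeRing)
open import Function.Bundles using (_↔_)

-- A finite field with exactly q elements (equality is propositional).
-- (Any such q is a prime power, and every prime power occurs.)
record FiniteField (q : ℕ) : Set₁ where
  field
    Carrier : Set
    _+_ _*_ : Op₂ Carrier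
    -_ : Op₁ Carrier
    0# 1# : Carrier
    isCommutativeRing : IsCommutativeRing _≡_ _+_ _*_ -_ 0# 1#
    0≢1 : ¬ (0# ≡ 1#)
    inverse : ∀ x → ¬ (x ≡ 0#) → Σ Carrier (λ y → (x * y) ≡ 1#)
    enumeration : Carrier ↔ Fin q

module _ {q : ℕ} (F : FiniteField q) (n : ℕ) where
  open FiniteField F

  Mat : Set
  Mat = Fin n → Fin n → Carrier

  _≐_ : Mat → Mat → Set
  A ≐ B = ∀ i j → A i j ≡ B i j

  Symmetric : Mat → Set
  Symmetric A = ∀ i j → A i j ≡ A j i

  _−_ : Mat → Mat → Mat
  (A − B) i j = A i j + (- B i j)

  RankOne : Mat → Set
  RankOne A = (∃₂ λ i j → ¬ (A i j ≡ 0#))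
            × (∃₂ λ (u v : Fin n → Carrier) → ∀ i j → A i j ≡ (u i * v j))

  Adjacent : Mat → Mat → Set
  Adjacent S S' = RankOne (S − S')

  -- A subset of S_n(F_q), given by its (decidable) membership function,
  -- is a line: a maximal set of rank 1.
  record IsLine (M : Mat → Bool) : Set where
    field
      respects   : ∀ A B → A ≐ B → M A ≡ M B
      points     : ∀ S → M S ≡ true → Symmetric S
      clique     : ∀ S S' → M S ≡ true → M S' ≡ true → ¬ (S ≐ S') → Adjacent S S'
      maximal    : ∀ P → Symmetric P → M P ≡ false →
                   ¬ (∀ S → M S ≡ true → Adjacent P S)

  record PointSet (T : List Mat) : Set where
    field
      allSymmetric : All Symmetric T
      distinct     : AllPairs (λ A B → ¬ (A ≐ B)) T

  -- number of points of T lying on the line M (= entry of H(n,q) · 1_T at row M, over ℤ)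
  meet : (Mat → Bool) → List Mat → ℕ
  meet M T = length (filterᵇ M T)

  -- T is the support of a codeword of C(n,q): H(n,q) · 1_T = 0 over F_2
  IsCodewordSupport : List Mat → Set
  IsCodewordSupport T = PointSet T × (∀ M → IsLine M → 2 ∣ meet M T)

  IsStoppingSet : List Mat → Set
  IsStoppingSet T = PointSet T × (∀ M → IsLine M → ¬ (meet M T ≡ 1))

  -- minimum distance bound: every nonzero codeword has weight w
  -- with w · (q − 1) ≥ 2 (qⁿ − 1), i.e. w ≥ 2(qⁿ−1)/(q−1)
  MinDistanceBound : Set
  MinDistanceBound = ∀ T → IsCodewordSupport T → ¬ (T ≡ []) →
                     (2 · (q ^ n ∸ 1)) ≤ (length T · (q ∸ 1))

  StoppingDistanceBound : Set
  StoppingDistanceBound = ∀ T → IsStoppingSet T → ¬ (T ≡ []) →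
                          (2 · (q ^ n ∸ 1)) ≤ (length T · (q ∸ 1))

{-# OPTIONS --safe #-}
-- For symmetric S and x ≠ 0 the set L(S, x) = {S + λ x xᵀ : λ ∈ F_q} is a line: its points
-- differ by rank-one matrices, and a symmetric P adjacent to both S and S + x xᵀ has
-- P − S = c u uᵀ with c u uᵀ − x xᵀ of rank one, which forces u ∥ x, i.e. P ∈ L(S, x).
-- Fix a point P of a nonempty stopping set T and pairwise independent vectors e, y₁, …, y_N,
-- N + 1 = (qⁿ − 1)/(q − 1). Every line L(B, x) with B ∈ T meets T in a second point
-- B + λ x xᵀ, λ ≠ 0; let Q = P + α e eᵀ be the one on L(P, e), and P_y, Q_y those on L(P, y),
-- L(Q, y). The 2(N + 1) points P, Q, P_y, Q_y of T are pairwise distinct, since a coincidence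
-- would make some a e eᵀ + b y yᵀ (a, b ≠ 0, e ∦ y) of rank at most one, whereas its 2 × 2
-- minors are a b (e_i y_j − e_j y_i)². A codeword support meets every line in an even number
-- of points, so it is a stopping set.
module Submission where

open import Defs
open import Data.Nat using (ℕ; _≤_)
open import Data.Product using (_×_)

open import Data.Nat as ℕ using (zero; suc; z≤n; s≤s)
import Data.Nat.Properties as ℕ
open import Data.Nat.Divisibility using (_∣_; ∣1⇒≡1)
open import Data.Nat.Tactic.RingSolver using (solve-∀)
open import Data.Integer as ℤ using (ℤ; -[1+_]; _⊖_)
import Data.Integer.Properties as ℤ
import Data.Sign as Sign
open import Data.Bool using (Bool; true)
open import Data.Bool.Properties using (T-≡)
open import Data.Fin using (Fin; zero; suc)
import Data.Fin.Properties as Fin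
open import Data.Maybe using (Maybe; just; nothing)
open import Data.Product using (Σ; ∃; ∃-syntax; _,_; proj₁; proj₂)
open import Data.List as List using (List; []; _∷_; _++_; [_]; length; map; tabulate; filterᵇ; cartesianProductWith)
import Data.List.Properties as List
open import Data.List.Relation.Unary.All as All using (All; []; _∷_)
import Data.List.Relation.Unary.All.Properties as All
open import Data.List.Relation.Unary.AllPairs as AllPairs using (AllPairs; []; _∷_)
import Data.List.Relation.Unary.AllPairs.Properties as AllPairs
open import Data.List.Relation.Unary.Any using (here; there; index; _─_)
open import Data.List.Membership.Propositional using (_∈_)
open import Data.List.Membership.Propositional.Properties using (∈-filter⁺; ∈-filter⁻)
open import Data.List.Relation.Unary.Unique.Propositional using (Unique)
import Data.List.Relation.Unary.Unique.Propositional.Properties as Unique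
import Data.List.Relation.Unary.Unique.Setoid as UniqueSetoid
import Data.List.Relation.Unary.Unique.Setoid.Properties as UniqueSetoid
open import Data.Vec.Functional using (Vector) renaming (_∷_ to _◂_)
open import Function.Base using (_∘_; _on_)
open import Function.Bundles using (Inverse; Equivalence; mk⇔)
open import Function.Properties.Inverse using (Inverse⇒Injection)
open import Relation.Binary.Core using (Rel)
open import Relation.Binary.Definitions using (DecidableEquality)
import Relation.Binary.Definitions as Binary
open import Relation.Binary.PropositionalEquality as ≡
  using (_≡_; _≢_; refl; cong; cong₂; subst; _≗_; _→-setoid_)
open import Relation.Nullary using (¬_; Dec; yes; no; does; contradiction)
open import Relation.Nullary.Decidable using (map′; via-injection; dec-true; does-⇔; T?)
open import Algebra.Bundles using (CommutativeRing)
open import Algebra.Solver.Ring.AlmostCommutativeRing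
  using (_-Raw-AlmostCommutative⟶_; fromCommutativeRing)
import Algebra.Properties.Ring as RingProperties
import Algebra.Properties.Semiring.Mult as SemiringMult
import Relation.Binary.Reasoning.Setoid as SetoidReasoning
import Algebra.Solver.Ring

-- Integer coefficients compute and map into every commutative ring, which is what the
-- stdlib ring solver needs to normalise expressions over an abstract ring.
module ℤ-RingSolver {c ℓ} (R : CommutativeRing c ℓ) where
  open CommutativeRing R renaming (refl to ≈-refl; sym to ≈-sym; trans to ≈-trans)
  open RingProperties ring using (-0#≈0#; -‿involutive; -‿+-comm; -‿distribˡ-*; -‿distribʳ-*)
  open SemiringMult semiring renaming (_×_ to _×′_) using (×-homo-+; ×1-homo-*)
  open SetoidReasoning setoid

  ⟦_⟧ : ℤ → Carrier
  ⟦ ℤ.+ n ⟧    = n ×′ 1#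
  ⟦ -[1+ n ] ⟧ = - (suc n ×′ 1#)

  ⊖-homo : ∀ m n → ⟦ m ⊖ n ⟧ ≈ m ×′ 1# - n ×′ 1#
  ⊖-homo m       zero    = begin
    m ×′ 1#            ≈⟨ +-identityʳ _ ⟨
    m ×′ 1# + 0#       ≈⟨ +-congˡ -0#≈0# ⟨
    m ×′ 1# - 0 ×′ 1#  ∎
  ⊖-homo zero    (suc n) = ≈-sym (+-identityˡ _)
  ⊖-homo (suc m) (suc n) = begin
    ⟦ suc m ⊖ suc n ⟧                  ≡⟨ ≡.cong ⟦_⟧ (ℤ.[1+m]⊖[1+n]≡m⊖n m n) ⟩
    ⟦ m ⊖ n ⟧                          ≈⟨ ⊖-homo m n ⟩
    m ×′ 1# - n ×′ 1#                  ≈⟨ +-congʳ (+-identityˡ _) ⟨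
    (0# + m ×′ 1#) - n ×′ 1#           ≈⟨ +-congʳ (+-congʳ (-‿inverseʳ 1#)) ⟨
    ((1# - 1#) + m ×′ 1#) - n ×′ 1#    ≈⟨ +-congʳ (+-assoc 1# (- 1#) _) ⟩
    (1# + (- 1# + m ×′ 1#)) - n ×′ 1#  ≈⟨ +-congʳ (+-congˡ (+-comm (- 1#) _)) ⟩
    (1# + (m ×′ 1# - 1#)) - n ×′ 1#    ≈⟨ +-congʳ (+-assoc 1# (m ×′ 1#) (- 1#)) ⟨
    ((1# + m ×′ 1#) - 1#) - n ×′ 1#    ≈⟨ +-assoc (1# + m ×′ 1#) (- 1#) _ ⟩
    (1# + m ×′ 1#) + (- 1# - n ×′ 1#)  ≈⟨ +-congˡ (-‿+-comm 1# (n ×′ 1#)) ⟩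
    suc m ×′ 1# - suc n ×′ 1#          ∎

  +-homo : ∀ i j → ⟦ i ℤ.+ j ⟧ ≈ ⟦ i ⟧ + ⟦ j ⟧
  +-homo (ℤ.+ m)  (ℤ.+ n)  = ×-homo-+ 1# m n
  +-homo (ℤ.+ m)  -[1+ n ] = ⊖-homo m (suc n)
  +-homo -[1+ m ] (ℤ.+ n)  = ≈-trans (⊖-homo n (suc m)) (+-comm _ _)
  +-homo -[1+ m ] -[1+ n ] = begin
    - (suc (suc m ℕ.+ n) ×′ 1#)        ≡⟨ ≡.cong (λ k → - (k ×′ 1#)) (ℕ.+-suc (suc m) n) ⟨
    - (suc m ℕ.+ suc n) ×′ 1#          ≈⟨ -‿cong (×-homo-+ 1# (suc m) (suc n)) ⟩
    - (suc m ×′ 1# + suc n ×′ 1#)      ≈⟨ -‿+-comm _ _ ⟨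
    - (suc m ×′ 1#) + - (suc n ×′ 1#)  ∎

  +◃-homo : ∀ n → ⟦ Sign.+ ℤ.◃ n ⟧ ≈ n ×′ 1#
  +◃-homo zero    = ≈-refl
  +◃-homo (suc n) = ≈-refl

  -◃-homo : ∀ n → ⟦ Sign.- ℤ.◃ n ⟧ ≈ - (n ×′ 1#)
  -◃-homo zero    = ≈-sym -0#≈0#
  -◃-homo (suc n) = ≈-refl

  *-homo : ∀ i j → ⟦ i ℤ.* j ⟧ ≈ ⟦ i ⟧ * ⟦ j ⟧
  *-homo (ℤ.+ m)  (ℤ.+ n)  = ≈-trans (+◃-homo (m ℕ.* n)) (×1-homo-* m n)
  *-homo (ℤ.+ m)  -[1+ n ] = begin
    ⟦ Sign.- ℤ.◃ (m ℕ.* suc n) ⟧  ≈⟨ -◃-homo (m ℕ.* suc n) ⟩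
    - ((m ℕ.* suc n) ×′ 1#)       ≈⟨ -‿cong (×1-homo-* m (suc n)) ⟩
    - (m ×′ 1# * suc n ×′ 1#)     ≈⟨ -‿distribʳ-* _ _ ⟩
    m ×′ 1# * - (suc n ×′ 1#)     ∎
  *-homo -[1+ m ] (ℤ.+ n)  = begin
    ⟦ Sign.- ℤ.◃ (suc m ℕ.* n) ⟧  ≈⟨ -◃-homo (suc m ℕ.* n) ⟩
    - ((suc m ℕ.* n) ×′ 1#)       ≈⟨ -‿cong (×1-homo-* (suc m) n) ⟩
    - (suc m ×′ 1# * n ×′ 1#)     ≈⟨ -‿distribˡ-* _ _ ⟩
    - (suc m ×′ 1#) * n ×′ 1#     ∎
  *-homo -[1+ m ] -[1+ n ] = begin
    (suc m ℕ.* suc n) ×′ 1#            ≈⟨ ×1-homo-* (suc m) (suc n) ⟩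
    suc m ×′ 1# * suc n ×′ 1#          ≈⟨ -‿involutive _ ⟨
    - - (suc m ×′ 1# * suc n ×′ 1#)    ≈⟨ -‿cong (-‿distribˡ-* _ _) ⟩
    - (- (suc m ×′ 1#) * suc n ×′ 1#)  ≈⟨ -‿distribʳ-* _ _ ⟩
    - (suc m ×′ 1#) * - (suc n ×′ 1#)  ∎

  -‿homo : ∀ i → ⟦ ℤ.- i ⟧ ≈ - ⟦ i ⟧
  -‿homo (ℤ.+ zero)  = ≈-sym -0#≈0#
  -‿homo (ℤ.+ suc n) = ≈-refl
  -‿homo -[1+ n ]    = ≈-sym (-‿involutive _)

  homomorphism : ℤ.+-*-rawRing -Raw-AlmostCommutative⟶ fromCommutativeRing R
  homomorphism = record
    { ⟦_⟧ = ⟦_⟧ ; +-homo = +-homo ; *-homo = *-homo ; -‿homo = -‿homo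
    ; 0-homo = ≈-refl ; 1-homo = +-identityʳ 1# }

  _≟ᶜ_ : ∀ i j → Maybe (⟦ i ⟧ ≈ ⟦ j ⟧)
  i ≟ᶜ j with i ℤ.≟ j
  ... | yes ≡.refl = just ≈-refl
  ... | no _       = nothing

  open Algebra.Solver.Ring ℤ.+-*-rawRing (fromCommutativeRing R) homomorphism _≟ᶜ_ public
    using (solve; _:=_; _:+_; _:*_; _:-_; :-_)

does≡true⇒ : ∀ {a} {A : Set a} (A? : Dec A) → does A? ≡ true → A
does≡true⇒ (yes a) _ = a

module _ {a} {A : Set a} where

  ∈-─⁺ : ∀ {x y} {xs : List A} (x∈xs : x ∈ xs) → y ∈ xs → x ≢ y → y ∈ (xs ─ x∈xs)
  ∈-─⁺ (here refl)  (here refl)  x≢y = contradiction refl x≢y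
  ∈-─⁺ (here refl)  (there y∈xs) _   = y∈xs
  ∈-─⁺ (there x∈xs) (here refl)  _   = here refl
  ∈-─⁺ (there x∈xs) (there y∈xs) x≢y = there (∈-─⁺ x∈xs y∈xs x≢y)

  Unique-⊆⇒length≤ : ∀ {xs ys : List A} → Unique xs → All (_∈ ys) xs → length xs ≤ length ys
  Unique-⊆⇒length≤ [] [] = z≤n
  Unique-⊆⇒length≤ {xs = _ ∷ xs} {ys} (x∉xs ∷ xs!) (x∈ys ∷ xs⊆ys) = begin
    suc (length xs)            ≤⟨ s≤s (Unique-⊆⇒length≤ xs! xs⊆ys─x) ⟩
    suc (length (ys ─ x∈ys))   ≡⟨ List.length-removeAt′ ys (index x∈ys) ⟨
    length ys                  ∎
    where
    open ℕ.≤-Reasoning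
    xs⊆ys─x : All (_∈ (ys ─ x∈ys)) xs
    xs⊆ys─x = All.zipWith (λ (x≢y , y∈ys) → ∈-─⁺ x∈ys y∈ys x≢y) (x∉xs , xs⊆ys)

  length-cartesianProductWith : ∀ {b c} {B : Set b} {C : Set c} (f : A → B → C) xs ys →
                                length (cartesianProductWith f xs ys) ≡ length xs ℕ.* length ys
  length-cartesianProductWith f []       ys = refl
  length-cartesianProductWith f (x ∷ xs) ys = begin
    length (map (f x) ys ++ cartesianProductWith f xs ys)
      ≡⟨ List.length-++ (map (f x) ys) ⟩
    length (map (f x) ys) ℕ.+ length (cartesianProductWith f xs ys)
      ≡⟨ cong₂ ℕ._+_ (List.length-map (f x) ys) (length-cartesianProductWith f xs ys) ⟩
    length ys ℕ.+ length xs ℕ.* length ys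
      ∎
    where open ≡.≡-Reasoning

  another-member : ∀ {ℓ} {_≉_ : Rel A ℓ} → Binary.Symmetric _≉_ → ∀ {x xs} →
                   AllPairs _≉_ xs → x ∈ xs → length xs ≢ 1 → ∃[ y ] y ∈ xs × y ≉ x
  another-member ≉-sym {xs = _ ∷ []}    _              (here refl) len≢1 = contradiction refl len≢1
  another-member ≉-sym {xs = _ ∷ y ∷ _} ((x≉y ∷ _) ∷ _) (here refl) _     = y , there (here refl) , ≉-sym x≉y
  another-member ≉-sym {xs = y ∷ _}     (y≉xs ∷ _)     (there x∈) _      = y , here refl , All.lookup y≉xs x∈

module _ {p : ℕ} (F : FiniteField (suc p)) where
  open FiniteField F using (Carrier; isCommutativeRing; 0≢1; inverse; enumeration)

  commutativeRing : CommutativeRing _ _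
  commutativeRing = record { isCommutativeRing = isCommutativeRing }

  open CommutativeRing commutativeRing
    using (_+_; _*_; -_; _-_; 0#; 1#; +-identityʳ; *-identityˡ; *-identityʳ; *-comm; zeroˡ; zeroʳ; -‿inverseʳ; ring)
  open RingProperties ring using (x∙y⁻¹≈ε⇒x≈y; -0#≈0#; -‿involutive)
  open ℤ-RingSolver commutativeRing using (solve; _:=_; _:+_; _:*_; _:-_; :-_)
  open Inverse enumeration using (to; from; strictlyInverseˡ; strictlyInverseʳ)
  open ≡.≡-Reasoning

  -- Finite fields

  _≟_ : DecidableEquality Carrier
  _≟_ = via-injection (Inverse⇒Injection enumeration) Fin._≟_

  ∃? : {P : Carrier → Set} → (∀ x → Dec (P x)) → Dec (∃ P)
  ∃? {P} P? = map′ (λ (i , Pi) → from i , Pi)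
                   (λ (x , Px) → to x , subst P (≡.sym (strictlyInverseʳ x)) Px)
                   (Fin.any? (P? ∘ from))

  1≢0 : 1# ≢ 0#
  1≢0 = 0≢1 ∘ ≡.sym

  inv : (x : Carrier) → x ≢ 0# → Carrier
  inv x x≢0 = proj₁ (inverse x x≢0)

  *-inverseʳ : ∀ x (x≢0 : x ≢ 0#) → x * inv x x≢0 ≡ 1#
  *-inverseʳ x x≢0 = proj₂ (inverse x x≢0)

  x*y≡z⇒y≡x⁻¹*z : ∀ {x y z} (x≢0 : x ≢ 0#) → x * y ≡ z → y ≡ inv x x≢0 * z
  x*y≡z⇒y≡x⁻¹*z {x} {y} {z} x≢0 xy≡z = begin
    y                    ≡⟨ *-identityˡ y ⟨
    1# * y               ≡⟨ cong (_* y) (*-inverseʳ x x≢0) ⟨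
    x * x⁻¹ * y          ≡⟨ solve 3 (λ x x⁻¹ y → x :* x⁻¹ :* y := x⁻¹ :* (x :* y)) refl x x⁻¹ y ⟩
    x⁻¹ * (x * y)        ≡⟨ cong (x⁻¹ *_) xy≡z ⟩
    x⁻¹ * z              ∎
    where x⁻¹ = inv x x≢0

  x*y≡0⇒y≡0 : ∀ {x y} → x ≢ 0# → x * y ≡ 0# → y ≡ 0#
  x*y≡0⇒y≡0 x≢0 xy≡0 = ≡.trans (x*y≡z⇒y≡x⁻¹*z x≢0 xy≡0) (zeroʳ _)

  *-≢0 : ∀ {x y} → x ≢ 0# → y ≢ 0# → x * y ≢ 0#
  *-≢0 x≢0 y≢0 xy≡0 = y≢0 (x*y≡0⇒y≡0 x≢0 xy≡0)

  inv-≢0 : ∀ {x} (x≢0 : x ≢ 0#) → inv x x≢0 ≢ 0#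
  inv-≢0 {x} x≢0 x⁻¹≡0 = 0≢1 (begin
    0#               ≡⟨ zeroʳ x ⟨
    x * 0#           ≡⟨ cong (x *_) x⁻¹≡0 ⟨
    x * inv x x≢0    ≡⟨ *-inverseʳ x x≢0 ⟩
    1#               ∎)

  x*y≢0⇒x≢0 : ∀ {x y} → x * y ≢ 0# → x ≢ 0#
  x*y≢0⇒x≢0 {y = y} xy≢0 x≡0 = xy≢0 (≡.trans (cong (_* y) x≡0) (zeroˡ y))

  x*y≢0⇒y≢0 : ∀ {x y} → x * y ≢ 0# → y ≢ 0#
  x*y≢0⇒y≢0 {x} xy≢0 y≡0 = xy≢0 (≡.trans (cong (x *_) y≡0) (zeroʳ x))

  -‿≢0 : ∀ {x} → x ≢ 0# → - x ≢ 0#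
  -‿≢0 {x} x≢0 -x≡0 = x≢0 (begin
    x        ≡⟨ -‿involutive x ⟨
    - - x    ≡⟨ cong -_ -x≡0 ⟩
    - 0#     ≡⟨ -0#≈0# ⟩
    0#       ∎)

  x*x≡0⇒x≡0 : ∀ {x} → x * x ≡ 0# → x ≡ 0#
  x*x≡0⇒x≡0 {x} xx≡0 with x ≟ 0#
  ... | yes x≡0 = x≡0
  ... | no  x≢0 = x*y≡0⇒y≡0 x≢0 xx≡0

  x-y≡0⇒x≡y : ∀ {x y} → x - y ≡ 0# → x ≡ y
  x-y≡0⇒x≡y = x∙y⁻¹≈ε⇒x≈y _ _

  -- Projective points

  elements : List Carrier
  elements = tabulate from

  length-elements : length elements ≡ suc p
  length-elements = List.length-tabulate from

  elements-unique : Unique elements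
  elements-unique = Unique.tabulate⁺ λ {i} {j} fromi≡fromj → begin
    i              ≡⟨ strictlyInverseˡ i ⟨
    to (from i)    ≡⟨ cong to fromi≡fromj ⟩
    to (from j)    ≡⟨ strictlyInverseˡ j ⟩
    j              ∎

  vectors : ∀ m → List (Vector Carrier m)
  vectors zero    = [ (λ ()) ]
  vectors (suc m) = cartesianProductWith _◂_ elements (vectors m)

  length-vectors : ∀ m → length (vectors m) ≡ suc p ℕ.^ m
  length-vectors zero    = refl
  length-vectors (suc m) = begin
    length (cartesianProductWith _◂_ elements (vectors m))   ≡⟨ length-cartesianProductWith _◂_ elements (vectors m) ⟩
    length elements ℕ.* length (vectors m)                   ≡⟨ cong₂ ℕ._*_ length-elements (length-vectors m) ⟩
    suc p ℕ.* suc p ℕ.^ m                                    ∎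

  vectors-unique : ∀ m → UniqueSetoid.Unique (Fin m →-setoid Carrier) (vectors m)
  vectors-unique zero    = [] ∷ []
  vectors-unique (suc m) =
    UniqueSetoid.cartesianProductWith⁺ (≡.setoid Carrier) (Fin m →-setoid Carrier) (Fin (suc m) →-setoid Carrier)
      _◂_ (λ x◂v≗y◂w → x◂v≗y◂w zero , x◂v≗y◂w ∘ suc) elements-unique (vectors-unique m)

  Parallel : ∀ {m} → Rel (Vector Carrier m) _
  Parallel x y = ∀ i j → x i * y j ≡ x j * y i

  NonZero : ∀ {m} → Vector Carrier m → Set
  NonZero x = ∃[ k ] x k ≢ 0#

  Direction : ℕ → Set
  Direction m = Σ (Vector Carrier m) NonZero

  Parallel-sym : ∀ {m} {x y : Vector Carrier m} → Parallel x y → Parallel y x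
  Parallel-sym {x = x} {y} x∥y i j = begin
    y i * x j    ≡⟨ *-comm (y i) (x j) ⟩
    x j * y i    ≡⟨ x∥y j i ⟩
    x i * y j    ≡⟨ *-comm (x i) (y j) ⟩
    y j * x i    ∎

  Independent : ∀ {m} → Rel (Direction m) _
  Independent = (λ x y → ¬ Parallel x y) on proj₁

  affinePoint : ∀ {m} → Vector Carrier m → Direction (suc m)
  affinePoint v = 1# ◂ v , zero , 1≢0

  pointAtInfinity : ∀ {m} → Direction m → Direction (suc m)
  pointAtInfinity (x , k , xk≢0) = 0# ◂ x , suc k , xk≢0

  projectivePoints : ∀ m → List (Direction m)
  projectivePoints zero    = []
  projectivePoints (suc m) = map affinePoint (vectors m) ++ map pointAtInfinity (projectivePoints m)

  length-projectivePoints : ∀ m → suc (length (projectivePoints m) ℕ.* p) ≡ suc p ℕ.^ m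
  length-projectivePoints zero    = refl
  length-projectivePoints (suc m) = begin
    suc (length (map affinePoint (vectors m) ++ map pointAtInfinity (projectivePoints m)) ℕ.* p)
      ≡⟨ cong (λ k → suc (k ℕ.* p)) (List.length-++ (map affinePoint (vectors m))) ⟩
    suc ((length (map affinePoint (vectors m)) ℕ.+ length (map pointAtInfinity (projectivePoints m))) ℕ.* p)
      ≡⟨ cong₂ (λ a b → suc ((a ℕ.+ b) ℕ.* p))
               (List.length-map affinePoint (vectors m)) (List.length-map pointAtInfinity (projectivePoints m)) ⟩
    suc ((length (vectors m) ℕ.+ length (projectivePoints m)) ℕ.* p)
      ≡⟨ cong (λ k → suc ((k ℕ.+ length (projectivePoints m)) ℕ.* p)) (length-vectors m) ⟩
    suc ((suc p ℕ.^ m ℕ.+ length (projectivePoints m)) ℕ.* p)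
      ≡⟨ split (suc p ℕ.^ m) (length (projectivePoints m)) p ⟩
    suc p ℕ.^ m ℕ.* p ℕ.+ suc (length (projectivePoints m) ℕ.* p)
      ≡⟨ cong (suc p ℕ.^ m ℕ.* p ℕ.+_) (length-projectivePoints m) ⟩
    suc p ℕ.^ m ℕ.* p ℕ.+ suc p ℕ.^ m
      ≡⟨ merge (suc p ℕ.^ m) p ⟩
    suc p ℕ.* suc p ℕ.^ m ∎
    where
    split : ∀ a b c → suc ((a ℕ.+ b) ℕ.* c) ≡ a ℕ.* c ℕ.+ suc (b ℕ.* c)
    split = solve-∀
    merge : ∀ a c → a ℕ.* c ℕ.+ a ≡ suc c ℕ.* a
    merge = solve-∀

  affinePoint-independent : ∀ {m} {v w : Vector Carrier m} → ¬ v ≗ w → Independent (affinePoint v) (affinePoint w)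
  affinePoint-independent {v = v} {w} v≉w parallel = v≉w λ j → begin
    v j          ≡⟨ *-identityʳ (v j) ⟨
    v j * 1#     ≡⟨ parallel (suc j) zero ⟩
    1# * w j     ≡⟨ *-identityˡ (w j) ⟩
    w j          ∎

  pointAtInfinity-independent : ∀ {m} {d e : Direction m} → Independent d e → Independent (pointAtInfinity d) (pointAtInfinity e)
  pointAtInfinity-independent d⊥e parallel = d⊥e λ i j → parallel (suc i) (suc j)

  affinePoint-independent-pointAtInfinity : ∀ {m} (v : Vector Carrier m) (d : Direction m) →
                                            Independent (affinePoint v) (pointAtInfinity d)
  affinePoint-independent-pointAtInfinity v (x , k , xk≢0) parallel = xk≢0 (begin
    x k          ≡⟨ *-identityˡ (x k) ⟨
    1# * x k     ≡⟨ parallel zero (suc k) ⟩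
    v k * 0#     ≡⟨ zeroʳ (v k) ⟩
    0#           ∎)

  projectivePoints-independent : ∀ m → AllPairs Independent (projectivePoints m)
  projectivePoints-independent zero    = []
  projectivePoints-independent (suc m) = AllPairs.++⁺
    (AllPairs.map⁺ (AllPairs.map affinePoint-independent (vectors-unique m)))
    (AllPairs.map⁺ (AllPairs.map (λ {d} {e} → pointAtInfinity-independent {d = d} {e}) (projectivePoints-independent m)))
    (All.map⁺ (All.universal (λ v → All.map⁺ (All.universal (affinePoint-independent-pointAtInfinity v) _)) _))

  -- Rank-one matrices and lines

  module _ {n : ℕ} where

    rankOne-minor : ∀ {A : Mat F n} {u v : Vector Carrier n} → (∀ i j → A i j ≡ u i * v j) →
                    ∀ i j → A i i * A j j ≡ A i j * A j i
    rankOne-minor {A} {u} {v} A≡uv i j = begin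
      A i i * A j j              ≡⟨ cong₂ _*_ (A≡uv i i) (A≡uv j j) ⟩
      u i * v i * (u j * v j)    ≡⟨ solve 4 (λ a b c d → a :* b :* (c :* d) := a :* d :* (c :* b)) refl (u i) (v i) (u j) (v j) ⟩
      u i * v j * (u j * v i)    ≡⟨ cong₂ _*_ (A≡uv i j) (A≡uv j i) ⟨
      A i j * A j i              ∎

    rankOne-sum⇒parallel : ∀ {α β} {x y u v : Vector Carrier n} → α ≢ 0# → β ≢ 0# →
                           (∀ i j → α * (x i * x j) + β * (y i * y j) ≡ u i * v j) → Parallel x y
    rankOne-sum⇒parallel {α} {β} {x} {y} α≢0 β≢0 B≡uv i j =
      x-y≡0⇒x≡y (x*x≡0⇒x≡0 (x*y≡0⇒y≡0 (*-≢0 α≢0 β≢0) (begin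
        α * β * (δ * δ)                  ≡⟨ solve 6 (λ α β xi xj yi yj →
                                              α :* β :* ((xi :* yj :- xj :* yi) :* (xi :* yj :- xj :* yi))
                                           := (α :* (xi :* xi) :+ β :* (yi :* yi)) :* (α :* (xj :* xj) :+ β :* (yj :* yj))
                                              :- (α :* (xi :* xj) :+ β :* (yi :* yj)) :* (α :* (xj :* xi) :+ β :* (yj :* yi)))
                                            refl α β (x i) (x j) (y i) (y j) ⟩
        B i i * B j j - B i j * B j i    ≡⟨ cong (_- B i j * B j i) (rankOne-minor {B} B≡uv i j) ⟩
        B i j * B j i - B i j * B j i    ≡⟨ -‿inverseʳ _ ⟩
        0#                               ∎)))
      where
      B : Mat F n
      B i j = α * (x i * x j) + β * (y i * y j)
      δ : Carrier
      δ = x i * y j - x j * y i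

    symmetric-rankOne : ∀ {D : Mat F n} {u v : Vector Carrier n} {a b} → Symmetric F n D → D a b ≢ 0# →
                        (∀ i j → D i j ≡ u i * v j) → ∃[ c ] c ≢ 0# × ∀ i j → D i j ≡ c * (u i * u j)
    symmetric-rankOne {D} {u} {v} {a} {b} D-sym Dab≢0 D≡uv = c , *-≢0 (inv-≢0 ub≢0) vb≢0 , D≡cuu
      where
      vb≢0 : v b ≢ 0#
      vb≢0 = x*y≢0⇒y≢0 λ uavb≡0 → Dab≢0 (≡.trans (D≡uv a b) uavb≡0)
      ub≢0 : u b ≢ 0#
      ub≢0 = x*y≢0⇒x≢0 λ ubva≡0 → Dab≢0 (≡.trans (D-sym a b) (≡.trans (D≡uv b a) ubva≡0))
      c : Carrier
      c = inv (u b) ub≢0 * v b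
      v≡cu : ∀ j → v j ≡ c * u j
      v≡cu j = begin
        v j                              ≡⟨ x*y≡z⇒y≡x⁻¹*z ub≢0 (begin
                                              u b * v j   ≡⟨ D≡uv b j ⟨
                                              D b j       ≡⟨ D-sym b j ⟩
                                              D j b       ≡⟨ D≡uv j b ⟩
                                              u j * v b   ∎) ⟩
        inv (u b) ub≢0 * (u j * v b)     ≡⟨ solve 3 (λ w uj vb → w :* (uj :* vb) := w :* vb :* uj) refl (inv (u b) ub≢0) (u j) (v b) ⟩
        c * u j                          ∎
      D≡cuu : ∀ i j → D i j ≡ c * (u i * u j)
      D≡cuu i j = begin
        D i j              ≡⟨ D≡uv i j ⟩
        u i * v j          ≡⟨ cong (u i *_) (v≡cu j) ⟩
        u i * (c * u j)    ≡⟨ solve 3 (λ ui c uj → ui :* (c :* uj) := c :* (ui :* uj)) refl (u i) c (u j) ⟩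
        c * (u i * u j)    ∎

    _≉_ : Rel (Mat F n) _
    A ≉ B = ¬ _≐_ F n A B

    ≉-sym : Binary.Symmetric _≉_
    ≉-sym A≉B B≐A = A≉B λ i j → ≡.sym (B≐A i j)

    ≉⇒entry≢ : ∀ {A B} → A ≉ B → ∃[ i ] ∃[ j ] A i j ≢ B i j
    ≉⇒entry≢ {A} {B} A≉B with Fin.¬∀⟶∃¬ n _ (λ i → Fin.all? λ j → A i j ≟ B i j) A≉B
    ... | i , ¬row with Fin.¬∀⟶∃¬ n _ (λ j → A i j ≟ B i j) ¬row
    ...   | j , Aij≢Bij = i , j , Aij≢Bij

    translate : Mat F n → Carrier → Vector Carrier n → Mat F n
    translate S l x i j = S i j + l * (x i * x j)

    OnLine : Mat F n → Vector Carrier n → Carrier → Mat F n → Set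
    OnLine S x l A = _≐_ F n A (translate S l x)

    onLine? : ∀ S x l A → Dec (OnLine S x l A)
    onLine? S x l A = Fin.all? λ i → Fin.all? λ j → A i j ≟ translate S l x i j

    line : Mat F n → Vector Carrier n → Mat F n → Bool
    line S x A = does (∃? λ l → onLine? S x l A)

    line-complete : ∀ {S x l A} → OnLine S x l A → line S x A ≡ true
    line-complete {S} {x} {l} {A} A∈ = dec-true (∃? λ l → onLine? S x l A) (l , A∈)

    line-sound : ∀ {S x A} → line S x A ≡ true → ∃[ l ] OnLine S x l A
    line-sound {S} {x} {A} = does≡true⇒ (∃? λ l → onLine? S x l A)

    onLine-adjacent : ∀ {S x l l' A B} → OnLine S x l A → OnLine S x l' B → A ≉ B → Adjacent F n A B
    onLine-adjacent {S} {x} {l} {l'} {A} {B} A∈ B∈ A≉B with ≉⇒entry≢ A≉B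
    ... | i , j , Aij≢Bij = (i , j , Aij≢Bij ∘ x-y≡0⇒x≡y) , (λ a → (l - l') * x a) , x , A-B≡
      where
      A-B≡ : ∀ a b → A a b - B a b ≡ (l - l') * x a * x b
      A-B≡ a b = begin
        A a b - B a b                                          ≡⟨ cong₂ _-_ (A∈ a b) (B∈ a b) ⟩
        (S a b + l * (x a * x b)) - (S a b + l' * (x a * x b))  ≡⟨ solve 5 (λ s l l' xa xb →
                                                                      (s :+ l :* (xa :* xb)) :- (s :+ l' :* (xa :* xb))
                                                                   := (l :- l') :* xa :* xb) refl (S a b) l l' (x a) (x b) ⟩
        (l - l') * x a * x b                                   ∎

    onLine-symmetric : ∀ {S x l A} → Symmetric F n S → OnLine S x l A → Symmetric F n A
    onLine-symmetric {S} {x} {l} {A} S-sym A∈ i j = begin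
      A i j                       ≡⟨ A∈ i j ⟩
      S i j + l * (x i * x j)     ≡⟨ cong₂ (λ s w → s + l * w) (S-sym i j) (*-comm (x i) (x j)) ⟩
      S j i + l * (x j * x i)     ≡⟨ A∈ j i ⟨
      A j i                       ∎

    onLine-base : ∀ {S} x → OnLine S x 0# S
    onLine-base {S} x i j = begin
      S i j                      ≡⟨ +-identityʳ (S i j) ⟨
      S i j + 0#                 ≡⟨ cong (S i j +_) (zeroˡ (x i * x j)) ⟨
      S i j + 0# * (x i * x j)   ∎

    adjacent-to-two-points⇒onLine : ∀ {S P x} → Symmetric F n S → Symmetric F n P → NonZero x →
                                    Adjacent F n P S → Adjacent F n P (translate S 1# x) → ∃[ l ] OnLine S x l P
    adjacent-to-two-points⇒onLine {S} {P} {x} S-sym P-sym (k , xk≢0) ((a , b , Dab≢0) , u , v , D≡uv) (_ , u' , v' , E≡u'v') =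
      c * t * t , P≡
      where
      D-square = symmetric-rankOne (λ i j → cong₂ _-_ (P-sym i j) (S-sym i j)) Dab≢0 D≡uv
      c = proj₁ D-square
      c≢0 = proj₁ (proj₂ D-square)
      D≡cuu = proj₂ (proj₂ D-square)
      E≡cuu-xx : ∀ i j → c * (u i * u j) + - 1# * (x i * x j) ≡ u' i * v' j
      E≡cuu-xx i j = begin
        c * (u i * u j) + - 1# * (x i * x j)     ≡⟨ cong (_+ - 1# * (x i * x j)) (D≡cuu i j) ⟨
        (P i j - S i j) + - 1# * (x i * x j)     ≡⟨ solve 5 (λ p s one xi xj → (p :- s) :+ (:- one) :* (xi :* xj)
                                                                        := p :- (s :+ one :* (xi :* xj))) refl (P i j) (S i j) 1# (x i) (x j) ⟩
        P i j - translate S 1# x i j             ≡⟨ E≡u'v' i j ⟩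
        u' i * v' j                              ∎
      u∥x : Parallel u x
      u∥x = rankOne-sum⇒parallel c≢0 (-‿≢0 1≢0) E≡cuu-xx
      t : Carrier
      t = inv (x k) xk≢0 * u k
      u≡tx : ∀ i → u i ≡ t * x i
      u≡tx i = begin
        u i                             ≡⟨ x*y≡z⇒y≡x⁻¹*z xk≢0 (≡.trans (*-comm (x k) (u i)) (u∥x i k)) ⟩
        inv (x k) xk≢0 * (u k * x i)    ≡⟨ solve 3 (λ w uk xi → w :* (uk :* xi) := w :* uk :* xi) refl (inv (x k) xk≢0) (u k) (x i) ⟩
        t * x i                         ∎
      P≡ : OnLine S x (c * t * t) P
      P≡ i j = begin
        P i j                              ≡⟨ solve 2 (λ p s → p := s :+ (p :- s)) refl (P i j) (S i j) ⟩
        S i j + (P i j - S i j)            ≡⟨ cong (S i j +_) (D≡cuu i j) ⟩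
        S i j + c * (u i * u j)            ≡⟨ cong₂ (λ ui uj → S i j + c * (ui * uj)) (u≡tx i) (u≡tx j) ⟩
        S i j + c * (t * x i * (t * x j))  ≡⟨ cong (S i j +_) (solve 4 (λ c t xi xj → c :* (t :* xi :* (t :* xj))
                                                                            := c :* t :* t :* (xi :* xj)) refl c t (x i) (x j)) ⟩
        S i j + c * t * t * (x i * x j)    ∎

    line-maximal : ∀ {S P} (x : Direction n) → Symmetric F n S → Symmetric F n P →
                   (∀ A → line S (proj₁ x) A ≡ true → Adjacent F n P A) → line S (proj₁ x) P ≡ true
    line-maximal {S} (x , x≢0) S-sym P-sym adjacent = line-complete (proj₂ (adjacent-to-two-points⇒onLine S-sym P-sym x≢0
      (adjacent S (line-complete (onLine-base x)))
      (adjacent (translate S 1# x) (line-complete {l = 1#} λ _ _ → refl))))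

    line-isLine : ∀ {S} (x : Direction n) → Symmetric F n S → IsLine F n (line S (proj₁ x))
    line-isLine {S} (x , x≢0) S-sym = record
      { respects = λ A B A≐B → does-⇔
          (mk⇔ (λ (l , A∈) → l , λ i j → ≡.trans (≡.sym (A≐B i j)) (A∈ i j))
               (λ (l , B∈) → l , λ i j → ≡.trans (A≐B i j) (B∈ i j)))
          (∃? λ l → onLine? S x l A) (∃? λ l → onLine? S x l B)
      ; points   = λ A A∈ → onLine-symmetric S-sym (proj₂ (line-sound A∈))
      ; clique   = λ A B A∈ B∈ → onLine-adjacent (proj₂ (line-sound A∈)) (proj₂ (line-sound B∈))
      ; maximal  = λ P P-sym P∉ adjacent → contradiction (≡.trans (≡.sym (line-maximal (x , x≢0) S-sym P-sym adjacent)) P∉) λ ()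
      }

    independent-lines-≉ : ∀ {B x y l l' R R'} → ¬ Parallel x y → l ≢ 0# → l' ≢ 0# →
                          OnLine B x l R → OnLine B y l' R' → R ≉ R'
    independent-lines-≉ {B} {x} {y} {l} {l'} {R} {R'} x∦y l≢0 l'≢0 R∈ R'∈ R≐R' =
      x∦y (rankOne-sum⇒parallel {u = λ _ → 0#} {v = λ _ → 0#} l≢0 (-‿≢0 l'≢0) λ i j → begin
        l * (x i * x j) + - l' * (y i * y j)                     ≡⟨ solve 5 (λ b l l' w w' → l :* w :+ (:- l') :* w'
                                                                                := (b :+ l :* w) :- (b :+ l' :* w'))
                                                                      refl (B i j) l l' (x i * x j) (y i * y j) ⟩
        (B i j + l * (x i * x j)) - (B i j + l' * (y i * y j))   ≡⟨ cong₂ _-_ (R∈ i j) (R'∈ i j) ⟨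
        R i j - R' i j                                           ≡⟨ cong (λ r → R i j - r) (R≐R' i j) ⟨
        R i j - R i j                                            ≡⟨ -‿inverseʳ (R i j) ⟩
        0#                                                       ≡⟨ zeroˡ 0# ⟨
        0# * 0#                                                  ∎)

    two-step-≉ : ∀ {P Q R R' e x y α l β} → ¬ Parallel e y → α ≢ 0# → β ≢ 0# →
                 OnLine P e α Q → OnLine P x l R → OnLine Q y β R' → R ≉ R'
    two-step-≉ {P} {Q} {R} {R'} {e} {x} {y} {α} {l} {β} e∦y α≢0 β≢0 Q∈ R∈ R'∈ R≐R' =
      e∦y (rankOne-sum⇒parallel {u = λ i → l * x i} {v = x} α≢0 β≢0 λ i j → begin
        α * (e i * e j) + β * (y i * y j)                        ≡⟨ solve 4 (λ p a w w' → a :+ w' := ((p :+ a) :+ w') :- p)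
                                                                      refl (P i j) (α * (e i * e j)) (x i * x j) (β * (y i * y j)) ⟩
        ((P i j + α * (e i * e j)) + β * (y i * y j)) - P i j    ≡⟨ cong (λ q → (q + β * (y i * y j)) - P i j) (Q∈ i j) ⟨
        (Q i j + β * (y i * y j)) - P i j                        ≡⟨ cong (_- P i j) (R'∈ i j) ⟨
        R' i j - P i j                                           ≡⟨ cong (_- P i j) (R≐R' i j) ⟨
        R i j - P i j                                            ≡⟨ cong (_- P i j) (R∈ i j) ⟩
        (P i j + l * (x i * x j)) - P i j                        ≡⟨ solve 4 (λ p l xi xj → (p :+ l :* (xi :* xj)) :- p := l :* xi :* xj)
                                                                      refl (P i j) l (x i) (x j) ⟩
        l * x i * x j                                            ∎)

  -- Stopping sets

  module StoppingSet {n} {T : List (Mat F n)} (T-points : PointSet F n T)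
                     (T-stopping : ∀ M → IsLine F n M → meet F n M T ≢ 1) where
    open PointSet T-points

    record SecondPoint (B : Mat F n) (x : Vector Carrier n) : Set where
      field
        point   : Mat F n
        point∈T : point ∈ T
        point≉B : point ≉ B
        scale   : Carrier
        onLine  : OnLine B x scale point

      scale≢0 : scale ≢ 0#
      scale≢0 scale≡0 = point≉B λ i j → begin
        point i j                  ≡⟨ onLine i j ⟩
        translate B scale x i j    ≡⟨ cong (λ l → translate B l x i j) scale≡0 ⟩
        translate B 0# x i j       ≡⟨ onLine-base {S = B} x i j ⟨
        B i j                      ∎

    secondPoint : ∀ {B} → B ∈ T → (x : Direction n) → SecondPoint B (proj₁ x)
    secondPoint {B} B∈T (x , x≢0) = record
      { point = R ; point∈T = proj₁ R∈T∩M ; point≉B = R≉B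
      ; scale = proj₁ R-onLine ; onLine = proj₂ R-onLine }
      where
      M = line B x
      B∈T∩M : B ∈ filterᵇ M T
      B∈T∩M = ∈-filter⁺ (T? ∘ M) B∈T (Equivalence.from T-≡ (line-complete (onLine-base x)))
      M-isLine : IsLine F n M
      M-isLine = line-isLine (x , x≢0) (All.lookup allSymmetric B∈T)
      other = another-member ≉-sym (AllPairs.filter⁺ (T? ∘ M) distinct) B∈T∩M (T-stopping M M-isLine)
      R = proj₁ other
      R≉B = proj₂ (proj₂ other)
      R∈T∩M = ∈-filter⁻ (T? ∘ M) (proj₁ (proj₂ other))
      R-onLine = line-sound (Equivalence.to T-≡ (proj₂ R∈T∩M))

    open SecondPoint

    star : ∀ {B} → B ∈ T → List (Direction n) → List (Mat F n)
    star {B} B∈T ds = B ∷ map (point ∘ secondPoint B∈T) ds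

    length-star : ∀ {B} (B∈T : B ∈ T) ds → length (star B∈T ds) ≡ suc (length ds)
    length-star B∈T ds = cong suc (List.length-map (point ∘ secondPoint B∈T) ds)

    star⊆T : ∀ {B} (B∈T : B ∈ T) ds → All (_∈ T) (star B∈T ds)
    star⊆T B∈T ds = B∈T ∷ All.map⁺ (All.universal (point∈T ∘ secondPoint B∈T) ds)

    star-distinct : ∀ {B} (B∈T : B ∈ T) {ds} → AllPairs Independent ds → AllPairs _≉_ (star B∈T ds)
    star-distinct B∈T {ds} ds-independent =
      All.map⁺ (All.universal (λ d → ≉-sym (point≉B (secondPoint B∈T d))) ds)
      ∷ AllPairs.map⁺ (AllPairs.map (λ {d} {d'} d⊥d' → independent-lines-≉ d⊥d'
          (scale≢0 (secondPoint B∈T d)) (scale≢0 (secondPoint B∈T d')) (onLine (secondPoint B∈T d)) (onLine (secondPoint B∈T d')))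
          ds-independent)

    module _ {P} (P∈T : P ∈ T) (e : Direction n) {ds} (e⊥ds : All (Independent e) ds) where
      Q : SecondPoint P (proj₁ e)
      Q = secondPoint P∈T e

      P-star-≉-Q-star : All (λ A → All (A ≉_) (star (point∈T Q) ds)) (star P∈T ds)
      P-star-≉-Q-star =
        (≉-sym (point≉B Q) ∷ All.map⁺ (All.map (λ {d} e⊥d →
            two-step-≉ e⊥d (scale≢0 Q) (scale≢0 (secondPoint (point∈T Q) d))
              (onLine Q) (onLine-base (proj₁ e)) (onLine (secondPoint (point∈T Q) d))) e⊥ds))
        ∷ All.map⁺ (All.map (λ {d} e⊥d →
            independent-lines-≉ (e⊥d ∘ Parallel-sym) (scale≢0 (secondPoint P∈T d)) (scale≢0 Q) (onLine (secondPoint P∈T d)) (onLine Q)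
            ∷ All.map⁺ (All.map (λ {d'} e⊥d' →
                two-step-≉ e⊥d' (scale≢0 Q) (scale≢0 (secondPoint (point∈T Q) d'))
                  (onLine Q) (onLine (secondPoint P∈T d)) (onLine (secondPoint (point∈T Q) d'))) e⊥ds)) e⊥ds)

    2*|ds|≤|T| : ∀ {P} → P ∈ T → ∀ ds → AllPairs Independent ds → 2 ℕ.* length ds ≤ length T
    2*|ds|≤|T| P∈T []       _                       = z≤n
    2*|ds|≤|T| P∈T (e ∷ ds) (e⊥ds ∷ ds-independent) =
      ℕ.≤-trans (ℕ.≤-reflexive length-stars) (Unique-⊆⇒length≤
        (AllPairs.map ≉⇒≢ (AllPairs.++⁺ (star-distinct P∈T ds-independent) (star-distinct Q∈T ds-independent)
                                        (P-star-≉-Q-star P∈T e e⊥ds)))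
        (All.++⁺ (star⊆T P∈T ds) (star⊆T Q∈T ds)))
      where
      Q∈T = point∈T (Q P∈T e e⊥ds)
      ≉⇒≢ : ∀ {A B} → A ≉ B → A ≢ B
      ≉⇒≢ A≉B refl = A≉B λ _ _ → refl
      length-stars : 2 ℕ.* suc (length ds) ≡ length (star P∈T ds ++ star Q∈T ds)
      length-stars = begin
        2 ℕ.* suc (length ds)                            ≡⟨ cong (suc (length ds) ℕ.+_) (ℕ.+-identityʳ _) ⟩
        suc (length ds) ℕ.+ suc (length ds)              ≡⟨ cong₂ ℕ._+_ (length-star P∈T ds) (length-star Q∈T ds) ⟨
        length (star P∈T ds) ℕ.+ length (star Q∈T ds)    ≡⟨ List.length-++ (star P∈T ds) ⟨
        length (star P∈T ds ++ star Q∈T ds)              ∎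

  stoppingSet-bound : ∀ {n} T → IsStoppingSet F n T → T ≢ [] → 2 ℕ.* (suc p ℕ.^ n ℕ.∸ 1) ≤ length T ℕ.* p
  stoppingSet-bound []      _                       []≢[] = contradiction refl []≢[]
  stoppingSet-bound {n} (P ∷ T) (T-points , T-stopping) _ =
    subst (λ k → 2 ℕ.* (k ℕ.∸ 1) ≤ length (P ∷ T) ℕ.* p) (length-projectivePoints n)
      (ℕ.≤-trans (ℕ.≤-reflexive (≡.sym (ℕ.*-assoc 2 (length (projectivePoints n)) p)))
                 (ℕ.*-monoˡ-≤ p (2*|ds|≤|T| (here refl) (projectivePoints n) (projectivePoints-independent n))))
    where open StoppingSet T-points T-stopping

stoppingDistanceBound : ∀ {q} (F : FiniteField q) n → StoppingDistanceBound F n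
stoppingDistanceBound {zero}  F n with Inverse.to (FiniteField.enumeration F) (FiniteField.0# F)
... | ()
stoppingDistanceBound {suc p} F n = stoppingSet-bound F

codewordSupport⇒stoppingSet : ∀ {q} (F : FiniteField q) n {T} → IsCodewordSupport F n T → IsStoppingSet F n T
codewordSupport⇒stoppingSet F n (T-points , T-even) =
  T-points , λ M M-isLine meet≡1 → contradiction (∣1⇒≡1 (subst (2 ∣_) meet≡1 (T-even M M-isLine))) λ ()

theorem4 : ∀ {q : ℕ} (F : FiniteField q) (n : ℕ) → 1 ≤ n →
           MinDistanceBound F n × StoppingDistanceBound F n
theorem4 F n _ =
  (λ T T-codeword → stoppingDistanceBound F n T (codewordSupport⇒stoppingSet F n T-codeword)) ,
  stoppingDistanceBound F n
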